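{- $\nu(3,3,3,3)=6$.
   Context: An $n$-uniform hypergraph is $n$-partite if its vertex set is the disjoint union of $n$ sets $V_1,\ldots,V_n$ and each edge meets each $V_i$ in exactly one vertex; it is written $(V_1,\ldots,V_n,E)$. An octahedral system is such a hypergraph with $|V_i|\ge 2$ for all $i$ satisfying the parity condition: for every $X\subseteq\bigcup_i V_i$ with $|X\cap V_i|=2$ for all $i$, the number of edges contained in $X$ is even. It is an $(m_1,\ldots,m_n)$-octahedral system if $|V_i|=m_i$ for all $i$. A vertex is isolated if it belongs to no edge. $\nu(m_1,\ldots,m_n)$ is the minimum number of edges over all $(m_1,\ldots,m_n)$-octahedral systems without isolated vertex. -}

module Defs where

open import Data.Nat using (ℕ; zero; suc; _≤_)
open import Data.Nat.Divisibility using (_∣_)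
open import Data.Fin using (Fin)
open import Data.Fin.Properties using (_≟_)
open import Data.List using (List; []; _∷_; length)
open import Data.List.Relation.Unary.AllPairs using (AllPairs)
open import Data.List.Relation.Unary.Any using (Any)
open import Data.Product using (Σ; _×_; _,_; ∃)
open import Data.Sum using (_⊎_)
open import Relation.Nullary using (¬_; Dec; yes; no)
open import Relation.Nullary.Decidable using (_⊎-dec_)
open import Relation.Binary.PropositionalEquality using (_≡_; _≢_)
open import Data.Fin.Properties using (all?)

-- An n-partite n-uniform hypergraph with parts V_i = Fin (m i).
-- An edge meets each V_i in exactly one vertex, so it is a choice function.
Edge : (n : ℕ) → (Fin n → ℕ) → Set
Edge n m = (i : Fin n) → Fin (m i)

DistinctEdges : ∀ {n m} → Edge n m → Edge n m → Set
DistinctEdges e f = ¬ (∀ i → e i ≡ f i)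

-- A set X meeting every V_i in exactly two vertices is given by
-- two choice functions a, b with a i ≠ b i for every i
-- (X ∩ V_i = {a i, b i}).
-- The edge e is contained in X.
_⊆X[_,_] : ∀ {n m} → Edge n m → Edge n m → Edge n m → Set
e ⊆X[ a , b ] = ∀ i → (e i ≡ a i) ⊎ (e i ≡ b i)

_⊆X?[_,_] : ∀ {n m} (e a b : Edge n m) → Dec (e ⊆X[ a , b ])
e ⊆X?[ a , b ] = all? (λ i → (e i ≟ a i) ⊎-dec (e i ≟ b i))

countIn : ∀ {n m} → Edge n m → Edge n m → List (Edge n m) → ℕ
countIn a b [] = 0
countIn a b (e ∷ es) with e ⊆X?[ a , b ]
... | yes _ = suc (countIn a b es)
... | no  _ = countIn a b es

-- An (m_1,...,m_n)-octahedral system: an edge set (a duplicate-free list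
-- of edges) satisfying the parity condition. (|V_i| ≥ 2 is imposed separately.)
record OctahedralSystem (n : ℕ) (m : Fin n → ℕ) : Set where
  field
    edges    : List (Edge n m)
    distinct : AllPairs DistinctEdges edges
    parity   : (a b : Edge n m) → (∀ i → a i ≢ b i) → 2 ∣ countIn a b edges

open OctahedralSystem public

numEdges : ∀ {n m} → OctahedralSystem n m → ℕ
numEdges H = length (edges H)

Isolated : ∀ {n m} → OctahedralSystem n m → (i : Fin n) → Fin (m i) → Set
Isolated H i v = ¬ Any (λ e → e i ≡ v) (edges H)

NoIsolated : ∀ {n m} → OctahedralSystem n m → Set
-- (stated positively: every vertex lies in some edge; classically ≡ ¬ Isolated)
NoIsolated H = ∀ i v → Any (λ e → e i ≡ v) (edges H)

ν≡ : (n : ℕ) → (Fin n → ℕ) → ℕ → Set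
ν≡ n m k =
  (Σ (OctahedralSystem n m) λ H → NoIsolated H × numEdges H ≡ k)
  × ((H : OctahedralSystem n m) → NoIsolated H → k ≤ numEdges H)

three⁴ : Fin 4 → ℕ
three⁴ _ = 3

module Submission where

-- An edge of a (3,…,3)-partite system on n parts is a point of the cube
-- {0,1,2}ⁿ, and the parity condition says that every box {a,b}ⁿ (with
-- a i ≠ b i for all i) contains an even number of edges.
--
-- Upper bound: the "staircase" 0ⁿ, 0ⁿ⁻¹1, 0ⁿ⁻²12, …, 12ⁿ⁻¹ together with
-- 2ⁿ is an octahedral system with n + 2 edges for every n; for n = 4 it
-- has no isolated vertex.
--
-- Lower bound: we show, for every n ≤ 4, that a nonempty octahedral list of
-- points of {0,1,2}ⁿ covering every vertex has more than n + 1 points. Splitting the points by their first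
-- coordinate gives three "links" in {0,1,2}ⁿ⁻¹; the parity condition is
-- equivalent to every union of two links being octahedral. With at most
-- n + 1 ≤ 5 points one link is a singleton {p}. If a second link is a
-- singleton it equals {p}, and p together with the third link is a smaller
-- counterexample one dimension down. Otherwise both other links are pairs,
-- each collinear with p, and a coordinate transversal to both lines is
-- constant on all points, leaving a vertex isolated.

open import Defs
open import Data.Nat using (ℕ; zero; suc; _+_; _≤_; _<_; s≤s; z≤n; s≤s⁻¹; _≤?_)
open import Data.Nat.Properties using (+-assoc; +-comm; +-suc; +-identityʳ; *-comm; +-mono-≤; ≤-trans; ≤-refl; <⇒≱; ≰⇒>; m≤n⇒m≤1+n)
open import Data.Nat.Divisibility using (_∣_; divides; ∣1⇒≡1)
open import Data.Fin using (Fin; zero; suc)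
open import Data.Fin.Properties using (_≟_; all?; ¬∀⟶∃¬)
open import Data.List using (List; []; _∷_; _++_; length; map)
open import Data.List.Properties using (++-assoc; ++-identityʳ)
open import Data.List.Relation.Unary.All as All using (All; []; _∷_)
open import Data.List.Relation.Unary.All.Properties using (All¬⇒¬Any)
open import Data.List.Relation.Unary.Any as Any using (Any; here; there; any?)
open import Data.List.Relation.Unary.AllPairs using (allPairs?)
open import Data.List.Membership.Propositional using (find; lose)
open import Data.Product using (Σ; ∃; _×_; _,_; proj₁; proj₂)
open import Data.Sum using (_⊎_; inj₁; inj₂)
open import Data.Empty using (⊥; ⊥-elim)
open import Data.Unit using (⊤; tt)
open import Function using (_∘_)
open import Relation.Nullary using (¬_; Dec; yes; no; ¬?)
open import Relation.Nullary.Decidable using (from-yes)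
open import Relation.Binary.PropositionalEquality
  using (_≡_; _≢_; refl; sym; trans; cong; cong₂; subst; subst₂; _≗_; ≢-sym; module ≡-Reasoning)

pattern 𝟘 = zero
pattern 𝟙 = suc zero
pattern 𝟚 = suc (suc zero)

Point : ℕ → Set
Point k = Edge k (λ _ → 3)

Octahedral : ∀ {k} → List (Point k) → Set
Octahedral L = ∀ a b → (∀ i → a i ≢ b i) → 2 ∣ countIn a b L

Covers : ∀ {k} → List (Point k) → Set
Covers L = ∀ i v → Any (λ e → e i ≡ v) L

-- Some element of Fin (3 + m) differs from two given ones; used both for
-- values (m = 0) and for coordinates.
avoid : ∀ {m} (x y : Fin (3 + m)) → Σ (Fin (3 + m)) λ z → z ≢ x × z ≢ y
avoid 𝟘 𝟘 = 𝟙 , (λ ()) , (λ ())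
avoid 𝟘 (suc 𝟘) = 𝟚 , (λ ()) , (λ ())
avoid 𝟘 (suc (suc _)) = 𝟙 , (λ ()) , (λ ())
avoid (suc 𝟘) 𝟘 = 𝟚 , (λ ()) , (λ ())
avoid (suc 𝟘) (suc _) = 𝟘 , (λ ()) , (λ ())
avoid (suc (suc _)) 𝟘 = 𝟙 , (λ ()) , (λ ())
avoid (suc (suc _)) (suc _) = 𝟘 , (λ ()) , (λ ())

other : Fin 3 → Fin 3
other x = proj₁ (avoid x x)

other≢ : ∀ x → other x ≢ x
other≢ x = proj₁ (proj₂ (avoid x x))

2∤1 : ¬ (2 ∣ 1)
2∤1 h with ∣1⇒≡1 h
... | ()

2∣n+n : ∀ n → 2 ∣ n + n
2∣n+n n = divides n (trans (cong (n +_) (sym (+-identityʳ n))) (*-comm 2 n))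

countIn-++ : ∀ {k} (a b : Point k) L M → countIn a b (L ++ M) ≡ countIn a b L + countIn a b M
countIn-++ a b [] M = refl
countIn-++ a b (e ∷ L) M with e ⊆X?[ a , b ]
... | yes _ = cong suc (countIn-++ a b L M)
... | no _ = countIn-++ a b L M

count-in : ∀ {k} {a b e : Point k} L → e ⊆X[ a , b ] → countIn a b (e ∷ L) ≡ suc (countIn a b L)
count-in {a = a} {b} {e} L h with e ⊆X?[ a , b ]
... | yes _ = refl
... | no ¬h = ⊥-elim (¬h h)

count-out : ∀ {k} {a b e : Point k} L → ¬ e ⊆X[ a , b ] → countIn a b (e ∷ L) ≡ countIn a b L
count-out {a = a} {b} {e} L ¬h with e ⊆X?[ a , b ]
... | yes h = ⊥-elim (¬h h)
... | no _ = refl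

oct-swap : ∀ {k} (L M : List (Point k)) → Octahedral (L ++ M) → Octahedral (M ++ L)
oct-swap L M o a b s = subst (2 ∣_) eq (o a b s)
  where
  eq : countIn a b (L ++ M) ≡ countIn a b (M ++ L)
  eq = trans (countIn-++ a b L M) (trans (+-comm (countIn a b L) _) (sym (countIn-++ a b M L)))

-- A doubled point is octahedral: every box contains it twice or not at all.
twin : ∀ {k} (p : Point k) → Octahedral (p ∷ p ∷ [])
twin p a b _ = subst (2 ∣_) (sym (countIn-++ a b (p ∷ []) (p ∷ []))) (2∣n+n (countIn a b (p ∷ [])))

-- A single point is not octahedral: it is alone in the box {p, other p}ᵏ.
single : ∀ {k} (p : Point k) → ¬ Octahedral (p ∷ [])
single p o = 2∤1 (subst (2 ∣_) (count-in {a = p} {b} [] λ _ → inj₁ refl) (o p b (≢-sym ∘ other≢ ∘ p)))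
  where
  b : Point _
  b = λ i → other (p i)

-- Two points form an octahedral list only if they coincide: otherwise the
-- box spanned by p and values avoiding both p and q contains p alone.
pair : ∀ {k} (p q : Point k) → Octahedral (p ∷ q ∷ []) → q ≗ p
pair {k} p q o with all? (λ i → q i ≟ p i)
... | yes q≗p = q≗p
... | no q≉p with ¬∀⟶∃¬ k _ (λ i → q i ≟ p i) q≉p
... | j , qj≢pj = ⊥-elim (2∤1 (subst (2 ∣_) count≡1 (o p b p≢b)))
  where
  b : Point k
  b = λ i → proj₁ (avoid (p i) (q i))
  p≢b : ∀ i → p i ≢ b i
  p≢b i = ≢-sym (proj₁ (proj₂ (avoid (p i) (q i))))
  q∉box : ¬ q ⊆X[ p , b ]
  q∉box h with h j
  ... | inj₁ qj≡pj = qj≢pj qj≡pj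
  ... | inj₂ qj≡bj = proj₂ (proj₂ (avoid (p j) (q j))) (sym qj≡bj)
  count≡1 : countIn p b (p ∷ q ∷ []) ≡ 1
  count≡1 = trans (count-in (q ∷ []) λ _ → inj₁ refl) (cong suc (count-out [] q∉box))

_◂_ : ∀ {k} → Fin 3 → Point k → Point (suc k)
(x ◂ p) zero = x
(x ◂ p) (suc i) = p i

tl : ∀ {k} → Point (suc k) → Point k
tl p i = p (suc i)

links : ∀ {k} → Fin 3 → List (Point (suc k)) → List (Point k)
links x [] = []
links x (e ∷ L) with e zero ≟ x
... | yes _ = tl e ∷ links x L
... | no _ = links x L

links-hit : ∀ {k x} (e : Point (suc k)) {L} → e zero ≡ x → links x (e ∷ L) ≡ tl e ∷ links x L
links-hit {x = x} e ex with e zero ≟ x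
... | yes _ = refl
... | no ne = ⊥-elim (ne ex)

links-miss : ∀ {k x} (e : Point (suc k)) {L} → e zero ≢ x → links x (e ∷ L) ≡ links x L
links-miss {x = x} e ne with e zero ≟ x
... | yes ex = ⊥-elim (ne ex)
... | no _ = refl

links-++ : ∀ {k} x (L M : List (Point (suc k))) → links x (L ++ M) ≡ links x L ++ links x M
links-++ x [] M = refl
links-++ x (e ∷ L) M with e zero ≟ x
... | yes _ = cong (tl e ∷_) (links-++ x L M)
... | no _ = links-++ x L M

box-tail : ∀ {k} {a b e : Point (suc k)} → (e zero ≡ a zero) ⊎ (e zero ≡ b zero) →
           countIn a b (e ∷ []) ≡ countIn (tl a) (tl b) (tl e ∷ [])
box-tail {a = a} {b} {e} head with e ⊆X?[ a , b ] | tl e ⊆X?[ tl a , tl b ]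
... | yes _ | yes _ = refl
... | no _ | no _ = refl
... | yes h | no ¬h = ⊥-elim (¬h (h ∘ suc))
... | no ¬h | yes h = ⊥-elim (¬h λ { zero → head ; (suc i) → h i })

box-head : ∀ {k} {a b e : Point (suc k)} → e zero ≢ a zero → e zero ≢ b zero → countIn a b (e ∷ []) ≡ 0
box-head {a = a} {b} {e} na nb = count-out {a = a} {b} {e} [] λ h → outside (h zero)
  where
  outside : ¬ ((e zero ≡ a zero) ⊎ (e zero ≡ b zero))
  outside (inj₁ ea) = na ea
  outside (inj₂ eb) = nb eb

split : ∀ {k} (a b : Point (suc k)) → a zero ≢ b zero → ∀ L →
        countIn a b L ≡ countIn (tl a) (tl b) (links (a zero) L) + countIn (tl a) (tl b) (links (b zero) L)
split a b ne [] = refl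
split a b ne (e ∷ L) =
  trans (countIn-++ a b (e ∷ []) L) (byFirstCoordinate (e zero ≟ a zero) (e zero ≟ b zero))
  where
  open ≡-Reasoning
  c : List (Point _) → ℕ
  c = countIn (tl a) (tl b)
  t X Y : ℕ
  t = c (tl e ∷ [])
  X = c (links (a zero) L)
  Y = c (links (b zero) L)
  byFirstCoordinate : Dec (e zero ≡ a zero) → Dec (e zero ≡ b zero) →
    countIn a b (e ∷ []) + countIn a b L ≡ c (links (a zero) (e ∷ L)) + c (links (b zero) (e ∷ L))
  byFirstCoordinate (yes ea) (yes eb) = ⊥-elim (ne (trans (sym ea) eb))
  byFirstCoordinate (yes ea) (no nb) = begin
    countIn a b (e ∷ []) + countIn a b L  ≡⟨ cong₂ _+_ (box-tail {a = a} {b} {e} (inj₁ ea)) (split a b ne L) ⟩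
    t + (X + Y)                           ≡⟨ sym (+-assoc t X Y) ⟩
    t + X + Y                             ≡⟨ cong (_+ Y) (sym (countIn-++ (tl a) (tl b) (tl e ∷ []) _)) ⟩
    c (tl e ∷ links (a zero) L) + Y       ≡⟨ sym (cong₂ (λ M N → c M + c N) (links-hit e ea) (links-miss e nb)) ⟩
    c (links (a zero) (e ∷ L)) + c (links (b zero) (e ∷ L)) ∎
  byFirstCoordinate (no na) (yes eb) = begin
    countIn a b (e ∷ []) + countIn a b L  ≡⟨ cong₂ _+_ (box-tail {a = a} {b} {e} (inj₂ eb)) (split a b ne L) ⟩
    t + (X + Y)                           ≡⟨ sym (+-assoc t X Y) ⟩
    t + X + Y                             ≡⟨ cong (_+ Y) (+-comm t X) ⟩
    X + t + Y                             ≡⟨ +-assoc X t Y ⟩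
    X + (t + Y)                           ≡⟨ cong (X +_) (sym (countIn-++ (tl a) (tl b) (tl e ∷ []) _)) ⟩
    X + c (tl e ∷ links (b zero) L)       ≡⟨ sym (cong₂ (λ M N → c M + c N) (links-miss e na) (links-hit e eb)) ⟩
    c (links (a zero) (e ∷ L)) + c (links (b zero) (e ∷ L)) ∎
  byFirstCoordinate (no na) (no nb) = begin
    countIn a b (e ∷ []) + countIn a b L  ≡⟨ cong₂ _+_ (box-head {a = a} {b} {e} na nb) (split a b ne L) ⟩
    X + Y                                 ≡⟨ sym (cong₂ (λ M N → c M + c N) (links-miss e na) (links-miss e nb)) ⟩
    c (links (a zero) (e ∷ L)) + c (links (b zero) (e ∷ L)) ∎

links-oct : ∀ {k} (L : List (Point (suc k))) → Octahedral L →
            ∀ {x y} → x ≢ y → Octahedral (links x L ++ links y L)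
links-oct L o {x} {y} x≢y a b s =
  subst (2 ∣_) (trans (split (x ◂ a) (y ◂ b) x≢y L) (sym (countIn-++ a b (links x L) (links y L))))
        (o (x ◂ a) (y ◂ b) λ { zero → x≢y ; (suc i) → s i })

oct-from-links : ∀ {k} (L : List (Point (suc k))) →
                 (∀ x y → x ≢ y → Octahedral (links x L ++ links y L)) → Octahedral L
oct-from-links L h a b s =
  subst (2 ∣_) (sym (trans (split a b (s zero) L) (sym (countIn-++ (tl a) (tl b) (links (a zero) L) (links (b zero) L)))))
        (h (a zero) (b zero) (s zero) (tl a) (tl b) (s ∘ suc))

length-links : ∀ {k} (L : List (Point (suc k))) →
               length L ≡ length (links 𝟘 L) + length (links 𝟙 L) + length (links 𝟚 L)
length-links [] = refl
length-links (e ∷ L) = place (e zero) refl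
  where
  a b c : ℕ
  a = length (links 𝟘 L)
  b = length (links 𝟙 L)
  c = length (links 𝟚 L)
  differ : ∀ {x y} → e zero ≡ x → x ≢ y → e zero ≢ y
  differ ex x≢y ey = x≢y (trans (sym ex) ey)
  lengths : ∀ {M₀ M₁ M₂} → links 𝟘 (e ∷ L) ≡ M₀ → links 𝟙 (e ∷ L) ≡ M₁ → links 𝟚 (e ∷ L) ≡ M₂ →
            length (links 𝟘 (e ∷ L)) + length (links 𝟙 (e ∷ L)) + length (links 𝟚 (e ∷ L)) ≡
            length M₀ + length M₁ + length M₂
  lengths h₀ h₁ h₂ = cong₂ _+_ (cong₂ _+_ (cong length h₀) (cong length h₁)) (cong length h₂)
  place : ∀ x → e zero ≡ x → suc (length L) ≡
          length (links 𝟘 (e ∷ L)) + length (links 𝟙 (e ∷ L)) + length (links 𝟚 (e ∷ L))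
  place 𝟘 e0 = sym (trans (lengths (links-hit e e0) (links-miss e (differ e0 λ ()))
                                   (links-miss e (differ e0 λ ())))
                          (cong suc (sym (length-links L))))
  place 𝟙 e1 = sym (trans (lengths (links-miss e (differ e1 λ ())) (links-hit e e1)
                                   (links-miss e (differ e1 λ ())))
                          (trans (cong (_+ c) (+-suc a b)) (cong suc (sym (length-links L)))))
  place 𝟚 e2 = sym (trans (lengths (links-miss e (differ e2 λ ())) (links-miss e (differ e2 λ ()))
                                   (links-hit e e2))
                          (trans (+-suc (a + b) c) (cong suc (sym (length-links L)))))

any-links : ∀ {k x} {P : Point k → Set} {L : List (Point (suc k))} →
            Any (λ e → e zero ≡ x × P (tl e)) L → Any P (links x L)
any-links {x = x} {L = e ∷ L} (here (ex , pe)) = subst (Any _) (sym (links-hit e ex)) (here pe)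
any-links {x = x} {L = e ∷ L} (there a) with e zero ≟ x
... | yes _ = there (any-links a)
... | no _ = any-links a

nonempty : ∀ {A : Set} {P : A → Set} {L : List A} → Any P L → 0 < length L
nonempty (here _) = s≤s z≤n
nonempty (there _) = s≤s z≤n

links-nonempty : ∀ {k} {L : List (Point (suc k))} → Covers L → ∀ x → 0 < length (links x L)
links-nonempty c x = nonempty (any-links {P = λ _ → ⊤} (Any.map (_, tt) (c zero x)))

Cover3 : ∀ {k} → List (Point k) → List (Point k) → List (Point k) → Set
Cover3 A B C = ∀ i v → Any (λ q → q i ≡ v) A ⊎ (Any (λ q → q i ≡ v) B ⊎ Any (λ q → q i ≡ v) C)

cover-swap₁₂ : ∀ {k} {A B C : List (Point k)} → Cover3 A B C → Cover3 B A C
cover-swap₁₂ c i v with c i v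
... | inj₁ h = inj₂ (inj₁ h)
... | inj₂ (inj₁ h) = inj₁ h
... | inj₂ (inj₂ h) = inj₂ (inj₂ h)

cover-swap₂₃ : ∀ {k} {A B C : List (Point k)} → Cover3 A B C → Cover3 A C B
cover-swap₂₃ c i v with c i v
... | inj₁ h = inj₁ h
... | inj₂ (inj₁ h) = inj₂ (inj₂ h)
... | inj₂ (inj₂ h) = inj₂ (inj₁ h)

links-cover : ∀ {k} {L : List (Point (suc k))} → Covers L → Cover3 (links 𝟘 L) (links 𝟙 L) (links 𝟚 L)
links-cover c i v with find (c (suc i) v)
... | e , e∈L , h with e zero | any-links (lose e∈L (refl , h))
... | 𝟘 | a = inj₁ a
... | 𝟙 | a = inj₂ (inj₁ a)
... | 𝟚 | a = inj₂ (inj₂ a)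

OnLine : ∀ {k} → Point k → List (Point k) → Fin k → Set
OnLine p M j = ∀ i → i ≢ j → All (λ q → q i ≡ p i) M

-- Induction on the
-- dimension via links: equal first coordinates pass to the tails; a first
-- coordinate taken exactly once yields a singleton link next to an empty
-- one; pairwise distinct first coordinates force equal tails.
line : ∀ k (p q r : Point (suc k)) → Octahedral (p ∷ q ∷ r ∷ []) → ∃ (OnLine p (q ∷ r ∷ []))
line zero p q r o = zero , λ { zero 0≢0 → ⊥-elim (0≢0 refl) }
line (suc k) p q r o = byFirstCoordinates (q zero ≟ p zero) (r zero ≟ p zero) (r zero ≟ q zero)
  where
  T : List (Point (suc (suc k)))
  T = p ∷ q ∷ r ∷ []
  hit : ∀ {v} e → e zero ≡ v → links v (e ∷ []) ≡ tl e ∷ []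
  hit e = links-hit e
  miss : ∀ {v} e → e zero ≢ v → links v (e ∷ []) ≡ []
  miss e = links-miss e
  linksAt : ∀ v {M₁ M₂ M₃} → links v (p ∷ []) ≡ M₁ → links v (q ∷ []) ≡ M₂ → links v (r ∷ []) ≡ M₃ →
            links v T ≡ M₁ ++ M₂ ++ M₃
  linksAt v {M₁} {M₂} {M₃} h₁ h₂ h₃ = begin
    links v T                                                 ≡⟨ links-++ v (p ∷ []) (q ∷ r ∷ []) ⟩
    links v (p ∷ []) ++ links v (q ∷ r ∷ [])                  ≡⟨ cong (links v (p ∷ []) ++_) (links-++ v (q ∷ []) (r ∷ [])) ⟩
    links v (p ∷ []) ++ links v (q ∷ []) ++ links v (r ∷ [])  ≡⟨ cong₂ _++_ h₁ (cong₂ _++_ h₂ h₃) ⟩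
    M₁ ++ M₂ ++ M₃ ∎
    where open ≡-Reasoning
  linkParity : ∀ {v w M N} → v ≢ w → links v T ≡ M → links w T ≡ N → Octahedral (M ++ N)
  linkParity v≢w eM eN = subst₂ (λ M N → Octahedral (M ++ N)) eM eN (links-oct T o v≢w)
  lonely : ∀ {v w e} → w ≢ v → links v T ≡ e ∷ [] → links w T ≡ [] → ⊥
  lonely {e = e} w≢v eV eW = single e (linkParity (≢-sym w≢v) eV eW)
  byFirstCoordinates : Dec (q zero ≡ p zero) → Dec (r zero ≡ p zero) → Dec (r zero ≡ q zero) →
                       ∃ (OnLine p (q ∷ r ∷ []))
  -- a common first coordinate: the tails are octahedral, recurse
  byFirstCoordinates (yes qp) (yes rp) _ with line k (tl p) (tl q) (tl r) tails
    where
    x w : Fin 3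
    x = p zero
    w = other x
    tails : Octahedral (tl p ∷ tl q ∷ tl r ∷ [])
    tails = linkParity (≢-sym (other≢ x))
              (linksAt x (hit p refl) (hit q qp) (hit r rp))
              (linksAt w (miss p (≢-sym (other≢ x))) (miss q λ q≡w → other≢ x (trans (sym q≡w) qp))
                         (miss r λ r≡w → other≢ x (trans (sym r≡w) rp)))
  ... | j , onLine = suc j , λ { zero _ → qp ∷ rp ∷ [] ; (suc i) i≢j → untail (onLine i (i≢j ∘ cong suc)) }
    where
    untail : ∀ {i} → All (λ s → s i ≡ tl p i) (tl q ∷ tl r ∷ []) → All (λ s → s (suc i) ≡ p (suc i)) (q ∷ r ∷ [])
    untail (qi ∷ ri ∷ []) = qi ∷ ri ∷ []
  -- r alone has its first coordinate, and some value w is taken by none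
  byFirstCoordinates (yes qp) (no rp) _ with avoid (p zero) (r zero)
  ... | w , w≢x , w≢z = ⊥-elim (lonely w≢z
    (linksAt (r zero) (miss p (≢-sym rp)) (miss q λ q≡z → rp (trans (sym q≡z) qp)) (hit r refl))
    (linksAt w (miss p (≢-sym w≢x)) (miss q λ q≡w → w≢x (trans (sym q≡w) qp)) (miss r (≢-sym w≢z))))
  byFirstCoordinates (no qp) (yes rp) _ with avoid (p zero) (q zero)
  ... | w , w≢x , w≢y = ⊥-elim (lonely w≢y
    (linksAt (q zero) (miss p (≢-sym qp)) (hit q refl) (miss r λ r≡y → qp (trans (sym r≡y) rp)))
    (linksAt w (miss p (≢-sym w≢x)) (miss q (≢-sym w≢y)) (miss r λ r≡w → w≢x (trans (sym r≡w) rp))))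
  byFirstCoordinates (no qp) (no rp) (yes rq) with avoid (p zero) (q zero)
  ... | w , w≢x , w≢y = ⊥-elim (lonely w≢x
    (linksAt (p zero) (hit p refl) (miss q qp) (miss r rp))
    (linksAt w (miss p (≢-sym w≢x)) (miss q (≢-sym w≢y)) (miss r λ r≡w → w≢y (trans (sym r≡w) rq))))
  -- three different first coordinates: the tails coincide pairwise
  byFirstCoordinates (no qp) (no rp) (no rq) = zero , λ
    { zero 0≢0 → ⊥-elim (0≢0 refl)
    ; (suc i) _ → tailQ i ∷ tailR i ∷ [] }
    where
    atP : links (p zero) T ≡ tl p ∷ []
    atP = linksAt (p zero) (hit p refl) (miss q qp) (miss r rp)
    tailQ : tl q ≗ tl p
    tailQ = pair (tl p) (tl q) (linkParity (≢-sym qp) atP (linksAt (q zero) (miss p (≢-sym qp)) (hit q refl) (miss r rq)))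
    tailR : tl r ≗ tl p
    tailR = pair (tl p) (tl r) (linkParity (≢-sym rp) atP (linksAt (r zero) (miss p (≢-sym rp)) (miss q (rq ∘ sym)) (hit r refl)))

misses : ∀ {k} {i : Fin k} {c : Fin 3} {M : List (Point k)} →
         All (λ q → q i ≡ c) M → ¬ Any (λ q → q i ≡ other c) M
misses {c = c} h = All¬⇒¬Any (All.map (λ qi≡c qi≡v → other≢ c (trans (sym qi≡v) qi≡c)) h)

frozen : ∀ {k} (i : Fin k) (c : Fin 3) {A B C : List (Point k)} →
         All (λ q → q i ≡ c) A → All (λ q → q i ≡ c) B → All (λ q → q i ≡ c) C → ¬ Cover3 A B C
frozen i c hA hB hC cov with cov i (other c)
... | inj₁ h = misses hA h
... | inj₂ (inj₁ h) = misses hB h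
... | inj₂ (inj₂ h) = misses hC h

-- Two lines through p in a cube of dimension at least 3: a coordinate
-- transversal to neither line is constant, so the links do not cover.
twoLines : ∀ {d} → 3 ≤ d → (p q q′ r r′ : Point d) →
           Octahedral (p ∷ q ∷ q′ ∷ []) → Octahedral (p ∷ r ∷ r′ ∷ []) →
           ¬ Cover3 (p ∷ []) (q ∷ q′ ∷ []) (r ∷ r′ ∷ [])
twoLines (s≤s (s≤s (s≤s _))) p q q′ r r′ oQ oR with line _ p q q′ oQ | line _ p r r′ oR
... | j , onQ | j′ , onR with avoid j j′
... | i , i≢j , i≢j′ = frozen i (p i) (refl ∷ []) (onQ i i≢j) (onR i i≢j′)

-- A second singleton link {q} next to {p} must equal it, and then the two
-- links merge into one.
mergeTwin : ∀ {k} {p q : Point k} {C} → q ≗ p → Cover3 (p ∷ []) (q ∷ []) C → Covers (p ∷ C)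
mergeTwin q≗p cov i v with cov i v
... | inj₁ (here pi≡v) = here pi≡v
... | inj₂ (inj₁ (here qi≡v)) = here (trans (sym (q≗p i)) qi≡v)
... | inj₂ (inj₂ h) = there h

SingletonCase : ℕ → ℕ → Set
SingletonCase k n = (p : Point k) (B C : List (Point k)) →
  Octahedral (p ∷ B) → Octahedral (p ∷ C) → 0 < length B → 0 < length C →
  length B + length C ≤ n → ¬ Cover3 (p ∷ []) B C

-- Three nonempty links with at most five points in total: one of them is a
-- singleton, and we may move it to the front.
findSingleton : ∀ {k n} → n ≤ 4 → SingletonCase k n → (A B C : List (Point k)) →
  Octahedral (A ++ B) → Octahedral (A ++ C) → Octahedral (B ++ C) →
  0 < length A → 0 < length B → 0 < length C →
  length A + length B + length C ≤ suc n → ¬ Cover3 A B C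
findSingleton _ handle (p ∷ []) B C oAB oAC _ _ nB nC len cov = handle p B C oAB oAC nB nC (s≤s⁻¹ len) cov
findSingleton {n = n} _ handle A@(_ ∷ _ ∷ _) (q ∷ []) C oAB _ oBC nA _ nC len cov =
  handle q A C (oct-swap A (q ∷ []) oAB) oBC nA nC (s≤s⁻¹ (subst (_≤ suc n) moveOne len)) (cover-swap₁₂ cov)
  where
  moveOne : length A + 1 + length C ≡ suc (length A + length C)
  moveOne = trans (+-assoc (length A) 1 (length C)) (+-suc (length A) (length C))
findSingleton {n = n} _ handle A@(_ ∷ _ ∷ _) B@(_ ∷ _ ∷ _) (r ∷ []) _ oAC oBC nA nB _ len cov =
  handle r A B (oct-swap A (r ∷ []) oAC) (oct-swap B (r ∷ []) oBC) nA nB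
       (s≤s⁻¹ (subst (_≤ suc n) (+-comm (length A + length B) 1) len)) (cover-swap₁₂ (cover-swap₂₃ cov))
findSingleton n≤4 _ A@(_ ∷ _ ∷ _) B@(_ ∷ _ ∷ _) C@(_ ∷ _ ∷ _) _ _ _ _ _ _ len _ =
  <⇒≱ (s≤s (s≤s n≤4)) (≤-trans sixPoints len)
  where
  sixPoints : 6 ≤ length A + length B + length C
  sixPoints = +-mono-≤ (+-mono-≤ (s≤s (s≤s z≤n)) (s≤s (s≤s z≤n))) (s≤s (s≤s z≤n))
findSingleton _ _ [] _ _ _ _ _ () _ _ _ _
findSingleton _ _ (_ ∷ _ ∷ _) [] _ _ _ _ _ () _ _ _
findSingleton _ _ (_ ∷ _ ∷ _) (_ ∷ _ ∷ _) [] _ _ _ _ _ () _ _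

CoverBound : ℕ → Set
CoverBound n = (L : List (Point n)) → 0 < length L → Octahedral L → Covers L → ¬ (length L ≤ suc n)

-- The singleton case in dimension d, given the bound one dimension down:
-- a second singleton link reduces to that bound, two pairs force d = 3 and
-- two lines, and any longer link exceeds the d + 1 ≤ 4 remaining points.
singletonStep : ∀ d → d ≤ 3 → CoverBound d → SingletonCase d (suc d)
singletonStep d _ bound p (q ∷ []) C oB oC _ _ len cov =
  bound (p ∷ C) (s≤s z≤n) oC (mergeTwin (pair p q oB) cov) len
singletonStep d _ bound p B (r ∷ []) oB oC _ _ len cov =
  bound (p ∷ B) (s≤s z≤n) oB (mergeTwin (pair p r oC) (cover-swap₂₃ cov)) (subst (_≤ suc d) (+-comm (length B) 1) len)
singletonStep d _ _ p (q ∷ q′ ∷ []) (r ∷ r′ ∷ []) oB oC _ _ len cov = twoLines (s≤s⁻¹ len) p q q′ r r′ oB oC cov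
singletonStep d d≤3 _ p B@(_ ∷ _ ∷ _ ∷ _) C@(_ ∷ _ ∷ _) _ _ _ _ len _ =
  <⇒≱ (s≤s (s≤s d≤3)) (≤-trans (+-mono-≤ {3} {length B} {2} {length C} (s≤s (s≤s (s≤s z≤n))) (s≤s (s≤s z≤n))) len)
singletonStep d d≤3 _ p B@(_ ∷ _ ∷ []) C@(_ ∷ _ ∷ _ ∷ _) _ _ _ _ len _ =
  <⇒≱ (s≤s (s≤s d≤3)) (≤-trans (+-mono-≤ {2} {length B} {3} {length C} (s≤s (s≤s z≤n)) (s≤s (s≤s (s≤s z≤n)))) len)
singletonStep d _ _ p [] _ _ _ () _ _ _
singletonStep d _ _ p (_ ∷ _ ∷ _) [] _ _ _ () _ _

-- In dimension 0 a single point is never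
-- octahedral; in dimension d + 1 the three links are nonempty, pairwise
-- octahedral, cover the tails, and have at most d + 2 ≤ 5 points together.
coverBound : ∀ n → n ≤ 4 → CoverBound n
coverBound zero _ [] () _ _ _
coverBound zero _ (p ∷ []) _ o _ _ = single p o
coverBound zero _ (_ ∷ _ ∷ _) _ _ _ (s≤s ())
coverBound (suc d) (s≤s d≤3) L _ o cov len =
  findSingleton (s≤s d≤3) (singletonStep d d≤3 (coverBound d (m≤n⇒m≤1+n d≤3)))
    (links 𝟘 L) (links 𝟙 L) (links 𝟚 L)
    (links-oct L o {𝟘} {𝟙} λ ()) (links-oct L o {𝟘} {𝟚} λ ()) (links-oct L o {𝟙} {𝟚} λ ())
    (links-nonempty cov 𝟘) (links-nonempty cov 𝟙) (links-nonempty cov 𝟚)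
    (subst (_≤ suc (suc d)) (length-links L) len) (links-cover cov)

top : ∀ k → Point k
top zero ()
top (suc k) = 𝟚 ◂ top k

-- 0ᵏ, 0ᵏ⁻¹1, 0ᵏ⁻²12, …, 12ᵏ⁻¹ (for k = 0 the unique point of {0,1,2}⁰).
staircase : ∀ k → List (Point k)
staircase zero = top zero ∷ []
staircase (suc k) = map (𝟘 ◂_) (staircase k) ++ (𝟙 ◂ top k) ∷ []

links-map-hit : ∀ {k} x (M : List (Point k)) → links x (map (x ◂_) M) ≡ M
links-map-hit x [] = refl
links-map-hit x (p ∷ M) = trans (links-hit (x ◂ p) refl) (cong (p ∷_) (links-map-hit x M))

links-map-miss : ∀ {k} {x y} (M : List (Point k)) → y ≢ x → links x (map (y ◂_) M) ≡ []
links-map-miss [] _ = refl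
links-map-miss (p ∷ M) y≢x = trans (links-miss (_ ◂ p) y≢x) (links-map-miss M y≢x)

stairLink : ∀ k → Fin 3 → List (Point k)
stairLink k 𝟘 = staircase k
stairLink k (suc _) = top k ∷ []

links-stair : ∀ k x → links x (map (𝟘 ◂_) (staircase k) ++ (𝟙 ◂ top k) ∷ (𝟚 ◂ top k) ∷ []) ≡ stairLink k x
links-stair k 𝟘 = trans (links-++ 𝟘 (map (𝟘 ◂_) (staircase k)) _)
                        (trans (cong (_++ []) (links-map-hit 𝟘 (staircase k))) (++-identityʳ (staircase k)))
links-stair k 𝟙 = trans (links-++ 𝟙 (map (𝟘 ◂_) (staircase k)) _)
                        (cong (_++ top k ∷ []) (links-map-miss (staircase k) λ ()))
links-stair k 𝟚 = trans (links-++ 𝟚 (map (𝟘 ◂_) (staircase k)) _)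
                        (cong (_++ top k ∷ []) (links-map-miss (staircase k) λ ()))

-- By induction via links: the links pair up as the smaller staircase
-- system or as a doubled top point.
staircase-octahedral : ∀ k → Octahedral (staircase k ++ top k ∷ [])
staircase-octahedral zero = twin (top zero)
staircase-octahedral (suc k) =
  subst Octahedral (sym (++-assoc (map (𝟘 ◂_) (staircase k)) ((𝟙 ◂ top k) ∷ []) ((𝟚 ◂ top k) ∷ [])))
        (oct-from-links (map (𝟘 ◂_) (staircase k) ++ (𝟙 ◂ top k) ∷ (𝟚 ◂ top k) ∷ []) λ x y x≢y →
          subst₂ (λ M N → Octahedral (M ++ N)) (sym (links-stair k x)) (sym (links-stair k y)) (pairOf x y x≢y))
  where
  pairOf : ∀ x y → x ≢ y → Octahedral (stairLink k x ++ stairLink k y)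
  pairOf 𝟘 𝟘 x≢y = ⊥-elim (x≢y refl)
  pairOf 𝟘 (suc _) _ = staircase-octahedral k
  pairOf (suc _) 𝟘 _ = oct-swap (staircase k) (top k ∷ []) (staircase-octahedral k)
  pairOf (suc _) (suc _) _ = twin (top k)

staircase₄ : List (Edge 4 three⁴)
staircase₄ = staircase 4 ++ top 4 ∷ []

staircaseSystem : OctahedralSystem 4 three⁴
staircaseSystem = record
  { edges = staircase₄
  ; distinct = from-yes (allPairs? (λ e f → ¬? (all? λ i → e i ≟ f i)) staircase₄)
  ; parity = staircase-octahedral 4
  }

staircase-covers : NoIsolated staircaseSystem
staircase-covers = from-yes (all? λ i → all? λ v → any? (λ e → e i ≟ v) staircase₄)

-- Five edges are too few by coverBound; the vertex (0,0) makes H nonempty.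
lowerBound : (H : OctahedralSystem 4 three⁴) → NoIsolated H → 6 ≤ numEdges H
lowerBound H cov with numEdges H ≤? 5
... | yes small = ⊥-elim (coverBound 4 ≤-refl (edges H) (nonempty (cov zero zero)) (parity H) cov small)
... | no large = ≰⇒> large

proposition5p1 : ν≡ 4 three⁴ 6
proposition5p1 = (staircaseSystem , staircase-covers , refl) , lowerBound
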